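{- Let $q \geq 2$ be an integer and let $\Sigma$ be an alphabet of size $q$. There exist constants $c > 0$ and $n_0$ (which may depend on $q$) such that for every $n \geq n_0$, the number of privileged words of length $n$ over $\Sigma$ is at least \[ \frac{c\,q^n}{n(\log_q n)^2}. \]
   Context: A border of a word $w$ is a non-empty word that is both a prefix and a suffix of $w$. A word $w$ is privileged if either $|w| \leq 1$, or $|w| \geq 2$ and $w$ has a border $u$ which is itself privileged and which occurs exactly twice as a factor of $w$ (i.e., there are exactly two positions in $w$ at which an occurrence of $u$ begins). The definition is recursive on length. -}

module Defs where

open import Data.List using (List; []; _∷_; _++_; length)
open import Data.Nat using (ℕ; _≤_; _<_)
open import Data.Product using (Σ; ∃; ∃-syntax; _×_)
open import Data.Sum using (_⊎_)
open import Relation.Binary.PropositionalEquality using (_≡_; _≢_)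

module _ {A : Set} where

  OccursAt : List A → List A → ℕ → Set
  OccursAt u w i = ∃[ x ] ∃[ y ] (length x ≡ i × x ++ u ++ y ≡ w)

  OccursExactlyTwice : List A → List A → Set
  OccursExactlyTwice u w =
    ∃[ i ] ∃[ j ] (i < j × OccursAt u w i × OccursAt u w j ×
      (∀ k → OccursAt u w k → k ≡ i ⊎ k ≡ j))

  Border : List A → List A → Set
  Border u w = u ≢ [] × (∃[ v ] u ++ v ≡ w) × (∃[ v ] v ++ u ≡ w)

  data Privileged : List A → Set where
    short : ∀ {w} → length w ≤ 1 → Privileged w
    step  : ∀ {w} u → 2 ≤ length w → Border u w → Privileged u →
            OccursExactlyTwice u w → Privileged w

-- Fix a block aʲ = a⋯a with q^j ≈ 2L, where q^L ≤ n < q^(L+1), and frame words with it: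
--   U y = aʲ bb y bb aʲ        W y x = U y bab x bab U y.
-- If y does not contain aʲ, the separators b confine every occurrence of aʲ in U y to its two ends, so U y is
-- privileged with border aʲ. If moreover x does not contain U y, then U y occurs in W y x only as prefix and
-- suffix (an occurrence starting in x would either lie inside x or put a b of U y onto the a of a separator
-- bab), so W y x is privileged with border U y. By a union bound over positions, a word of length N avoids a
-- fixed word p in at least half of all cases once 2(N+1) ≤ q^|p|; this holds for y with |y| ≈ L against aʲ and
-- for x with |x| ≈ n against U y. Since (y, x) can be read off from W y x, this yields ≥ q^(|y|+|x|)/4 distinct
-- privileged words of length n = |y| + |x| + L + 2j + 12, i.e. ≥ q^n / (64 q^16 n L²) of them.

module Submission where

open import Defs
open import Data.Nat using (ℕ; zero; suc; _+_; _*_; _^_; _≤_; _<_; z≤n; s≤s; s≤s⁻¹; NonZero; _≤?_)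
open import Data.Nat.Properties hiding (_≟_)
open import Data.Nat.DivMod using (_/_; _%_; m≡m%n+[m/n]*n; m%n<n)
open import Data.Nat.Tactic.RingSolver using (solve-∀)
open import Algebra.Properties.CommutativeSemigroup *-commutativeSemigroup using (x∙yz≈y∙xz)
open import Data.Fin using (Fin; zero; suc)
open import Data.Fin.Properties using (_≟_)
open import Data.List
  using (List; []; _∷_; _++_; length; replicate; take; drop; map; filter; allFin; cartesianProductWith; cartesianProduct)
open import Data.List.Properties
  using (length-++; length-map; length-replicate; length-tabulate; ++-assoc; ++-identityʳ; ++-conicalˡ;
         ∷-injective; ∷-injectiveˡ; filter-++; filter-all; filter-none; filter-≐; map-∘; map-id-local)
open import Data.List.Relation.Unary.All as All using (All; []; _∷_)
import Data.List.Relation.Unary.All.Properties as All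
open import Data.List.Relation.Unary.Unique.Propositional using (Unique; []; _∷_)
import Data.List.Relation.Unary.Unique.Propositional.Properties as Unique
open import Data.List.Relation.Binary.Infix.Heterogeneous using (Infix; here; there; _++ⁱ_)
open import Data.List.Relation.Binary.Infix.Heterogeneous.Properties using (infix?)
open import Data.List.Relation.Binary.Prefix.Heterogeneous as Prefix using (Prefix; []; _∷_; _++ᵖ_)
open import Data.List.Relation.Binary.Prefix.Heterogeneous.Properties using (prefix?; fromPointwise)
open import Data.List.Relation.Binary.Pointwise using (≡⇒Pointwise-≡)
open import Data.Product using (∃-syntax; _×_; _,_; proj₁; proj₂; uncurry)
open import Data.Sum using (_⊎_; inj₁; inj₂)
open import Data.Empty using (⊥-elim)
open import Function using (_∘_; id)
open import Level using (0ℓ)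
open import Relation.Nullary using (¬_; yes; no; ¬?; contradiction)
open import Relation.Nullary.Decidable using (_×-dec_)
open import Relation.Unary using (Pred; Decidable)
open import Relation.Binary.PropositionalEquality

-- Occurrences of factors

module _ {A : Set} where

  private variable
    u v w xs ys zs : List A
    c d : A
    i k : ℕ

  occursAt-∷ : OccursAt u w i → OccursAt u (c ∷ w) (suc i)
  occursAt-∷ {c = c} (x , y , refl , refl) = c ∷ x , y , refl , refl

  occursAt-∷⁻ : OccursAt u (c ∷ w) (suc i) → OccursAt u w i
  occursAt-∷⁻ (_ ∷ x , y , refl , refl) = x , y , refl , refl

  occursAt-drop : ∀ xs → OccursAt u (xs ++ w) (length xs + i) → OccursAt u w i
  occursAt-drop []       o = o
  occursAt-drop (_ ∷ xs) o = occursAt-drop xs (occursAt-∷⁻ o)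

  occursAt-0⇒prefix : OccursAt u w 0 → ∃[ v ] u ++ v ≡ w
  occursAt-0⇒prefix ([] , y , refl , refl) = y , refl

  occursAt-prefix : OccursAt (u ++ v) w k → OccursAt u w k
  occursAt-prefix {u = u} {v = v} (x , y , refl , refl) =
    x , v ++ y , refl , cong (x ++_) (sym (++-assoc u v y))

  occursAt-suffix : OccursAt (u ++ v) w k → OccursAt v w (k + length u)
  occursAt-suffix {u = u} {v = v} (x , y , refl , refl) =
    x ++ u , y , length-++ x ,
    trans (++-assoc x u (v ++ y)) (cong (x ++_) (sym (++-assoc u v y)))

  occursAt-length : OccursAt u w k → k + length u ≤ length w
  occursAt-length {u = u} (x , y , refl , refl) = begin
    length x + length u                ≤⟨ m≤m+n _ (length y) ⟩
    length x + length u + length y     ≡⟨ +-assoc (length x) _ _ ⟩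
    length x + (length u + length y)   ≡⟨ cong (length x +_) (length-++ u) ⟨
    length x + length (u ++ y)         ≡⟨ length-++ x ⟨
    length (x ++ u ++ y)               ∎
    where open ≤-Reasoning

  occursAt-self : OccursAt u u k → k ≡ 0
  occursAt-self {u = u} {k = k} o = n≤0⇒n≡0 (+-cancelʳ-≤ (length u) k 0 (occursAt-length o))

  occursAt⇒infix : OccursAt u w k → Infix _≡_ u w
  occursAt⇒infix (x , y , _ , refl) = x ++ⁱ here (fromPointwise (≡⇒Pointwise-≡ refl) ++ᵖ y)

  prefix-of-++ˡ : ∀ u → u ++ v ≡ xs ++ ys → length u ≤ length xs → ∃[ v′ ] u ++ v′ ≡ xs
  prefix-of-++ˡ {xs = xs} [] _ _ = xs , refl
  prefix-of-++ˡ {xs = _ ∷ xs} (_ ∷ u) eq (s≤s h) with ∷-injective eq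
  ... | refl , eq′ with prefix-of-++ˡ {xs = xs} u eq′ h
  ...   | v′ , refl = v′ , refl

  occursAt-take : ∀ xs → OccursAt u (xs ++ ys) k → k + length u ≤ length xs → OccursAt u xs k
  occursAt-take {u = u} {k = zero} xs o h with occursAt-0⇒prefix o
  ... | _ , eq with prefix-of-++ˡ u eq h
  ...   | v′ , eq′ = [] , v′ , refl , eq′
  occursAt-take {k = suc k} (_ ∷ xs) o (s≤s h) = occursAt-∷ (occursAt-take xs (occursAt-∷⁻ o) h)

  prefix-before-separator : ∀ u → All (c ≢_) u → u ++ v ≡ xs ++ c ∷ zs → ∃[ v′ ] u ++ v′ ≡ xs
  prefix-before-separator []      _ _ = _ , refl
  prefix-before-separator {xs = []} (_ ∷ u) (c≢d ∷ _) eq = ⊥-elim (c≢d (sym (∷-injectiveˡ eq)))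
  prefix-before-separator {xs = _ ∷ xs} (_ ∷ u) (_ ∷ c∉u) eq with ∷-injective eq
  ... | refl , eq′ with prefix-before-separator {xs = xs} u c∉u eq′
  ...   | v′ , refl = v′ , refl

  occursAt-separator : ∀ xs → All (c ≢_) u → OccursAt u (xs ++ c ∷ zs) k →
                       OccursAt u xs k ⊎ ∃[ i ] (OccursAt u zs i × k ≡ length xs + suc i)
  occursAt-separator {u = u} {k = zero} xs c∉u o with occursAt-0⇒prefix o
  ... | _ , eq with prefix-before-separator u c∉u eq
  ...   | v′ , eq′ = inj₁ ([] , v′ , refl , eq′)
  occursAt-separator {k = suc k} []       c∉u o = inj₂ (k , occursAt-∷⁻ o , refl)
  occursAt-separator {k = suc k} (_ ∷ xs) c∉u o with occursAt-separator xs c∉u (occursAt-∷⁻ o)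
  ... | inj₁ o′             = inj₁ (occursAt-∷ o′)
  ... | inj₂ (i , o′ , eq) = inj₂ (i , o′ , cong suc eq)

  take-drop-middle : ∀ (s m t : List A) → take (length m) (drop (length s) (s ++ m ++ t)) ≡ m
  take-drop-middle []      []      t = refl
  take-drop-middle []      (c ∷ m) t = cong (c ∷_) (take-drop-middle [] m t)
  take-drop-middle (_ ∷ s) m       t = take-drop-middle s m t

  occursAt-letter : ∀ s s′ {t t′} → OccursAt u w k → u ≡ s ++ c ∷ t → w ≡ s′ ++ d ∷ t′ →
                    k + length s ≡ length s′ → c ≡ d
  occursAt-letter s s′ o refl refl eq = ∷-injectiveˡ (proj₂ (occursAt-0⇒prefix at-0))
    where
    at-0 = occursAt-drop s′ (subst (OccursAt _ _) (trans eq (sym (+-identityʳ _))) (occursAt-suffix {u = s} o))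

  -- Privileged words with a prescribed border

  privileged-by-border : ∀ {u w} s v → Privileged u → u ≢ [] → s ≢ [] → u ++ v ≡ w → s ++ u ≡ w →
                         (∀ k → OccursAt u w k → k ≡ 0 ⊎ k ≡ length s) → Privileged w
  privileged-by-border {u} {w} s v pu u≢[] s≢[] pre suf ends =
    step u 2≤|w| (u≢[] , (v , pre) , (s , suf)) pu
      (0 , length s , 0<|s| , ([] , v , refl , pre) , (s , [] , refl , trans (cong (s ++_) (++-identityʳ u)) suf) , ends)
    where
    nonempty : ∀ {xs : List A} → xs ≢ [] → 1 ≤ length xs
    nonempty {[]}    ne = ⊥-elim (ne refl)
    nonempty {_ ∷ _} _  = s≤s z≤n
    0<|s| : 0 < length s
    0<|s| = nonempty s≢[]
    2≤|w| : 2 ≤ length w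
    2≤|w| = subst (2 ≤_) (trans (sym (length-++ s)) (cong length suf)) (+-mono-≤ 0<|s| (nonempty u≢[]))

  replicate-privileged : ∀ n (c : A) → Privileged (replicate n c)
  replicate-privileged zero          c = short z≤n
  replicate-privileged (suc zero)    c = short (s≤s z≤n)
  replicate-privileged (suc (suc n)) c =
    privileged-by-border (c ∷ []) (c ∷ []) (replicate-privileged (suc n) c) (λ ()) (λ ()) (snoc (suc n)) refl ends
    where
    snoc : ∀ m → replicate m c ++ c ∷ [] ≡ c ∷ replicate m c
    snoc zero    = refl
    snoc (suc m) = cong (c ∷_) (snoc m)
    ends : ∀ k → OccursAt (replicate (suc n) c) (replicate (suc (suc n)) c) k → k ≡ 0 ⊎ k ≡ 1
    ends k o with +-cancelʳ-≤ (suc n) k 1 (subst₂ (λ l m → k + l ≤ m)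
                    (length-replicate (suc n)) (length-replicate (suc (suc n))) (occursAt-length o))
    ... | z≤n     = inj₁ refl
    ... | s≤s z≤n = inj₂ refl

  frame : List A → List A → List A → List A
  frame p s m = p ++ s ++ m ++ s ++ p

  frame-init : List A → List A → List A → List A
  frame-init p s m = p ++ s ++ m ++ s

  frame-init-++ : ∀ p s m → frame-init p s m ++ p ≡ frame p s m
  frame-init-++ p s m = begin
    (p ++ s ++ m ++ s) ++ p   ≡⟨ ++-assoc p _ p ⟩
    p ++ (s ++ m ++ s) ++ p   ≡⟨ cong (p ++_) (++-assoc s _ p) ⟩
    p ++ s ++ (m ++ s) ++ p   ≡⟨ cong (λ z → p ++ s ++ z) (++-assoc m s p) ⟩
    p ++ s ++ m ++ s ++ p     ∎
    where open ≡-Reasoning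

  length-frame : ∀ p s m → length (frame p s m) ≡ length (frame-init p s m) + length p
  length-frame p s m = trans (cong length (sym (frame-init-++ p s m))) (length-++ (frame-init p s m))

  length-frame-init : ∀ p s m → length (frame-init p s m) ≡ length p + (length s + (length m + length s))
  length-frame-init p s m =
    trans (length-++ p) (cong (length p +_) (trans (length-++ s) (cong (length s +_) (length-++ m))))

  frame-privileged : ∀ {p} s m → Privileged p → p ≢ [] →
                     (∀ k → OccursAt p (frame p s m) k → k ≡ 0 ⊎ k ≡ length (frame-init p s m)) →
                     Privileged (frame p s m)
  frame-privileged {p} s m pp p≢[] =
    privileged-by-border (frame-init p s m) (s ++ m ++ s ++ p) pp p≢[] (p≢[] ∘ ++-conicalˡ p _) refl (frame-init-++ p s m)

-- The framed words U y and W y x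

module Construction {A : Set} (a b : A) (a≢b : a ≢ b) (j : ℕ) (2≤j : 2 ≤ j) where

  aʲ : List A
  aʲ = replicate j a

  U : List A → List A
  U y = frame aʲ (b ∷ b ∷ []) y

  W : List A → List A → List A
  W y x = frame (U y) (b ∷ a ∷ b ∷ []) x

  -- U y = V y ++ aʲ and W y x = P y x ++ U y: the lengths of V y and P y x are where the second borders start.
  V : List A → List A
  V y = frame-init aʲ (b ∷ b ∷ []) y

  P : List A → List A → List A
  P y x = frame-init (U y) (b ∷ a ∷ b ∷ []) x

  private variable
    x y : List A
    k : ℕ

  length-aʲ : length aʲ ≡ j
  length-aʲ = length-replicate j

  aʲ≢[] : aʲ ≢ []
  aʲ≢[] eq with subst (2 ≤_) (trans (sym length-aʲ) (cong length eq)) 2≤j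
  ... | ()

  b∉aʲ : All (b ≢_) aʲ
  b∉aʲ = All.replicate⁺ j (a≢b ∘ sym)

  aʲ-absent-from-short : ∀ {w} → length w < j → ¬ OccursAt aʲ w k
  aʲ-absent-from-short {k = k} |w|<j o =
    <⇒≱ |w|<j (≤-trans (m≤n+m j k) (subst (λ l → k + l ≤ _) length-aʲ (occursAt-length o)))

  aʲ-after : ∀ xs {zs} → (∀ {i} → ¬ OccursAt aʲ xs i) → OccursAt aʲ (xs ++ b ∷ zs) k →
             ∃[ i ] (OccursAt aʲ zs i × k ≡ length xs + suc i)
  aʲ-after xs absent o with occursAt-separator xs b∉aʲ o
  ... | inj₁ o′ = ⊥-elim (absent o′)
  ... | inj₂ r  = r

  aʲ-in-U : ¬ Infix _≡_ aʲ y → ∀ k → OccursAt aʲ (U y) k → k ≡ 0 ⊎ k ≡ length (V y)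
  aʲ-in-U {y} avoid k o with occursAt-separator aʲ b∉aʲ o
  ... | inj₁ o₁ = inj₁ (occursAt-self o₁)
  ... | inj₂ (_ , o₁ , refl) with aʲ-after [] (aʲ-absent-from-short (≤-trans (s≤s z≤n) 2≤j)) o₁
  ...   | _ , o₂ , refl with aʲ-after y (avoid ∘ occursAt⇒infix) o₂
  ...     | _ , o₃ , refl with aʲ-after [] (aʲ-absent-from-short (≤-trans (s≤s z≤n) 2≤j)) o₃
  ...       | _ , o₄ , refl with occursAt-self o₄
  ...         | refl = inj₂ (sym (length-frame-init aʲ (b ∷ b ∷ []) y))

  U-privileged : ¬ Infix _≡_ aʲ y → Privileged (U y)
  U-privileged {y} avoid = frame-privileged (b ∷ b ∷ []) y (replicate-privileged j a) aʲ≢[] (aʲ-in-U avoid)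

  length-U≡V+aʲ : ∀ y → length (U y) ≡ length (V y) + length aʲ
  length-U≡V+aʲ y = length-frame aʲ (b ∷ b ∷ []) y

  length-W≡P+U : ∀ y x → length (W y x) ≡ length (P y x) + length (U y)
  length-W≡P+U y x = length-frame (U y) (b ∷ a ∷ b ∷ []) x

  ℓU : ℕ → ℕ
  ℓU Y = j + (2 + (Y + 2)) + j

  ℓW : ℕ → ℕ → ℕ
  ℓW Y M = ℓU Y + (3 + (M + 3)) + ℓU Y

  length-U : ∀ y → length (U y) ≡ ℓU (length y)
  length-U y = trans (length-U≡V+aʲ y)
    (cong₂ _+_ (trans (length-frame-init aʲ (b ∷ b ∷ []) y) (cong (_+ _) length-aʲ)) length-aʲ)

  length-W : ∀ y x → length (W y x) ≡ ℓW (length y) (length x)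
  length-W y x = trans (length-W≡P+U y x)
    (trans (cong (_+ length (U y)) (length-frame-init (U y) (b ∷ a ∷ b ∷ []) x))
           (cong (λ u → u + (3 + (length x + 3)) + u) (length-U y)))

  aʲ-in-W : ¬ Infix _≡_ aʲ y → OccursAt aʲ (W y x) k →
            (k ≡ 0 ⊎ k ≡ length (V y))
            ⊎ (∃[ i ] (OccursAt aʲ x i × k ≡ length (U y) + (3 + i)))
            ⊎ (∃[ i ] ((i ≡ 0 ⊎ i ≡ length (V y)) × k ≡ length (P y x) + i))
  aʲ-in-W {y} {x} avoid o with occursAt-separator (U y) b∉aʲ o
  ... | inj₁ o₁ = inj₁ (aʲ-in-U avoid _ o₁)
  ... | inj₂ (_ , o₁ , refl) with aʲ-after (a ∷ []) (aʲ-absent-from-short 2≤j) o₁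
  ...   | _ , o₂ , refl with occursAt-separator x b∉aʲ o₂
  ...     | inj₁ o₃ = inj₂ (inj₁ (_ , o₃ , refl))
  ...     | inj₂ (_ , o₃ , refl) with aʲ-after (a ∷ []) (aʲ-absent-from-short 2≤j) o₃
  ...       | i , o₄ , refl = inj₂ (inj₂ (i , aʲ-in-U avoid i o₄ , sym (begin
    length (P y x) + i                            ≡⟨ cong (_+ i) (length-frame-init (U y) (b ∷ a ∷ b ∷ []) x) ⟩
    length (U y) + (3 + (length x + 3)) + i       ≡⟨ +-assoc (length (U y)) _ i ⟩
    length (U y) + (3 + (length x + 3) + i)       ≡⟨ cong (λ l → length (U y) + suc (suc (suc l))) (+-assoc (length x) 3 i) ⟩
    length (U y) + (3 + (length x + (3 + i)))     ∎)))
    where open ≡-Reasoning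

  length-V≢0 : ∀ y → length (V y) ≢ 0
  length-V≢0 y eq with m+n≡0⇒n≡0 (length aʲ) (trans (sym (length-++ aʲ)) eq)
  ... | ()

  aʲ-at-end-of : ∀ {w} → OccursAt (U y) w k → OccursAt aʲ w (k + length (V y))
  aʲ-at-end-of {y = y} {k = k} {w = w} o =
    occursAt-suffix {u = V y} (subst (λ z → OccursAt z w k) (sym (frame-init-++ aʲ (b ∷ b ∷ []) y)) o)

  -- Letter clashes: an occurrence at either position would put a b of U y onto the a of a separator bab.
  U-not-at-V : ¬ OccursAt (U y) (W y x) (length (V y))
  U-not-at-V {y} {x} o =
    a≢b (sym (occursAt-letter (aʲ ++ b ∷ []) (U y ++ b ∷ []) o
                (sym (++-assoc aʲ (b ∷ []) _)) (sym (++-assoc (U y) (b ∷ []) _)) aligned))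
    where
    open ≡-Reasoning
    aligned : length (V y) + length (aʲ ++ b ∷ []) ≡ length (U y ++ b ∷ [])
    aligned = begin
      length (V y) + length (aʲ ++ b ∷ [])   ≡⟨ cong (length (V y) +_) (length-++ aʲ) ⟩
      length (V y) + (length aʲ + 1)         ≡⟨ +-assoc (length (V y)) _ 1 ⟨
      length (V y) + length aʲ + 1           ≡⟨ cong (_+ 1) (length-U≡V+aʲ y) ⟨
      length (U y) + 1                       ≡⟨ length-++ (U y) ⟨
      length (U y ++ b ∷ [])                 ∎

  U-not-before-last : OccursAt (U y) (W y x) k → k + length (V y) ≢ length (P y x)
  U-not-before-last {y} {x} {k} o e =
    a≢b (sym (occursAt-letter (aʲ ++ b ∷ b ∷ y) s′ o (sym (++-assoc aʲ (b ∷ b ∷ y) _)) (sym (split-at-a (U y))) aligned))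
    where
    open ≡-Reasoning
    s′ = U y ++ b ∷ a ∷ b ∷ x ++ b ∷ []
    split-at-a : ∀ t → s′ ++ a ∷ b ∷ t ≡ U y ++ b ∷ a ∷ b ∷ x ++ b ∷ a ∷ b ∷ t
    split-at-a t = trans (++-assoc (U y) _ _) (cong (λ z → U y ++ b ∷ a ∷ b ∷ z) (++-assoc x (b ∷ []) _))
    aligned : k + length (aʲ ++ b ∷ b ∷ y) ≡ length s′
    aligned = +-cancelʳ-≡ 2 _ _ (begin
      k + length (aʲ ++ b ∷ b ∷ y) + 2     ≡⟨ +-assoc k _ 2 ⟩
      k + (length (aʲ ++ b ∷ b ∷ y) + 2)
        ≡⟨ cong (k +_) (trans (cong length (sym (++-assoc aʲ (b ∷ b ∷ y) (b ∷ b ∷ [])))) (length-++ (aʲ ++ b ∷ b ∷ y))) ⟨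
      k + length (V y)                     ≡⟨ e ⟩
      length (P y x)                       ≡⟨ trans (sym (length-++ s′)) (cong length (split-at-a [])) ⟨
      length s′ + 2                        ∎)

  U-not-past-P : ¬ OccursAt (U y) (W y x) (length (P y x) + length (V y))
  U-not-past-P {y} {x} o = length-V≢0 y (n≤0⇒n≡0 (+-cancelʳ-≤ (length (P y x) + length (U y)) _ 0 (begin
    length (V y) + (length (P y x) + length (U y))   ≡⟨ +-assoc (length (V y)) _ _ ⟨
    length (V y) + length (P y x) + length (U y)     ≡⟨ cong (_+ length (U y)) (+-comm (length (V y)) _) ⟩
    length (P y x) + length (V y) + length (U y)     ≤⟨ occursAt-length o ⟩
    length (W y x)                                   ≡⟨ length-W≡P+U y x ⟩
    length (P y x) + length (U y)                    ∎)))
    where open ≤-Reasoning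

  U-not-inside-x : ¬ Infix _≡_ (U y) x → ∀ {i i′} → OccursAt (U y) (W y x) (length (U y) + (3 + i)) →
                   OccursAt aʲ x i′ → length (U y) + (3 + i) + length (V y) ≢ length (U y) + (3 + i′)
  U-not-inside-x {y} {x} avx {i} {i′} o o′ e =
    avx (occursAt⇒infix (occursAt-take x (occursAt-drop (b ∷ a ∷ b ∷ []) (occursAt-drop (U y) o)) fits))
    where
    shift : i + length (V y) ≡ i′
    shift = +-cancelˡ-≡ 3 _ _ (+-cancelˡ-≡ (length (U y)) _ _ (trans (sym (+-assoc (length (U y)) _ _)) e))
    fits : i + length (U y) ≤ length x
    fits = begin
      i + length (U y)                  ≡⟨ cong (i +_) (length-U≡V+aʲ y) ⟩
      i + (length (V y) + length aʲ)    ≡⟨ +-assoc i _ _ ⟨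
      i + length (V y) + length aʲ      ≡⟨ cong (_+ length aʲ) shift ⟩
      i′ + length aʲ                     ≤⟨ occursAt-length o′ ⟩
      length x                          ∎
      where open ≤-Reasoning

  U-starting-in-x : ¬ Infix _≡_ aʲ y → ¬ Infix _≡_ (U y) x → ∀ {i} → OccursAt aʲ x i →
                    OccursAt (U y) (W y x) (length (U y) + (3 + i)) → length (U y) + (3 + i) ≡ length (P y x)
  U-starting-in-x {y} {x} avy avx {i} _ o with aʲ-in-W avy (aʲ-at-end-of o)
  ... | inj₁ (inj₁ e)                   = ⊥-elim (m+1+n≢0 (length (U y)) (m+n≡0⇒m≡0 _ e))
  ... | inj₁ (inj₂ e)                   = ⊥-elim (m+1+n≢0 (length (U y)) (+-cancelʳ-≡ (length (V y)) _ 0 e))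
  ... | inj₂ (inj₁ (_ , o′ , e))        = ⊥-elim (U-not-inside-x avx o o′ e)
  ... | inj₂ (inj₂ (_ , inj₁ refl , e)) = ⊥-elim (U-not-before-last o (trans e (+-identityʳ _)))
  ... | inj₂ (inj₂ (_ , inj₂ refl , e)) = +-cancelʳ-≡ (length (V y)) _ _ e

  U-in-W : ¬ Infix _≡_ aʲ y → ¬ Infix _≡_ (U y) x → ∀ k → OccursAt (U y) (W y x) k → k ≡ 0 ⊎ k ≡ length (P y x)
  U-in-W {y} {x} avy avx k o with aʲ-in-W avy (occursAt-prefix {u = aʲ} o)
  ... | inj₁ (inj₁ k≡0)                    = inj₁ k≡0
  ... | inj₁ (inj₂ refl)                   = ⊥-elim (U-not-at-V o)
  ... | inj₂ (inj₁ (_ , oᵢ , refl))        = inj₂ (U-starting-in-x avy avx oᵢ o)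
  ... | inj₂ (inj₂ (_ , inj₁ refl , refl)) = inj₂ (+-identityʳ _)
  ... | inj₂ (inj₂ (_ , inj₂ refl , refl)) = ⊥-elim (U-not-past-P o)

  W-privileged : ¬ Infix _≡_ aʲ y → ¬ Infix _≡_ (U y) x → Privileged (W y x)
  W-privileged {y} {x} avy avx =
    frame-privileged (b ∷ a ∷ b ∷ []) x (U-privileged avy) (aʲ≢[] ∘ ++-conicalˡ aʲ _) (U-in-W avy avx)

  W-around-y : ∀ y x → W y x ≡ (aʲ ++ b ∷ b ∷ []) ++ y ++ b ∷ b ∷ aʲ ++ b ∷ a ∷ b ∷ x ++ b ∷ a ∷ b ∷ U y
  W-around-y y x = begin
    (aʲ ++ b ∷ b ∷ y ++ b ∷ b ∷ aʲ) ++ rest       ≡⟨ ++-assoc aʲ _ rest ⟩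
    aʲ ++ b ∷ b ∷ (y ++ b ∷ b ∷ aʲ) ++ rest       ≡⟨ cong (λ z → aʲ ++ b ∷ b ∷ z) (++-assoc y _ rest) ⟩
    aʲ ++ b ∷ b ∷ y ++ b ∷ b ∷ aʲ ++ rest         ≡⟨ ++-assoc aʲ (b ∷ b ∷ []) _ ⟨
    (aʲ ++ b ∷ b ∷ []) ++ y ++ b ∷ b ∷ aʲ ++ rest ∎
    where
    open ≡-Reasoning
    rest = b ∷ a ∷ b ∷ x ++ b ∷ a ∷ b ∷ U y

  decode : ℕ → ℕ → List A → List A × List A
  decode Y M w = let y = take Y (drop (length (aʲ ++ b ∷ b ∷ [])) w) in
                 y , take M (drop (length (U y ++ b ∷ a ∷ b ∷ [])) w)

  decode-W : ∀ y x → decode (length y) (length x) (W y x) ≡ (y , x)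
  decode-W y x = cong₂ _,_ y-decoded
    (trans (cong (λ y′ → take (length x) (drop (length (U y′ ++ b ∷ a ∷ b ∷ [])) (W y x))) y-decoded) x-decoded)
    where
    y-decoded : take (length y) (drop (length (aʲ ++ b ∷ b ∷ [])) (W y x)) ≡ y
    y-decoded = trans (cong (take (length y) ∘ drop (length (aʲ ++ b ∷ b ∷ []))) (W-around-y y x))
                      (take-drop-middle (aʲ ++ b ∷ b ∷ []) y _)
    x-decoded : take (length x) (drop (length (U y ++ b ∷ a ∷ b ∷ [])) (W y x)) ≡ x
    x-decoded = trans (cong (take (length x) ∘ drop (length (U y ++ b ∷ a ∷ b ∷ [])))
                            (sym (++-assoc (U y) (b ∷ a ∷ b ∷ []) _)))
                      (take-drop-middle (U y ++ b ∷ a ∷ b ∷ []) x _)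

-- Counting words that avoid a factor

module _ {A : Set} where

  count : {P : Pred A 0ℓ} → Decidable P → List A → ℕ
  count P? xs = length (filter P? xs)

  private variable
    P Q R : Pred A 0ℓ
    xs ys : List A

  count-++ : (P? : Decidable P) → ∀ xs → count P? (xs ++ ys) ≡ count P? xs + count P? ys
  count-++ P? xs = trans (cong length (filter-++ P? xs _)) (length-++ (filter P? xs))

  count-∷ : (P? : Decidable P) → ∀ {x} xs → count P? xs ≤ count P? (x ∷ xs)
  count-∷ P? {x} xs with P? x
  ... | yes _ = n≤1+n _
  ... | no  _ = ≤-refl

  count-⊎ : (P? : Decidable P) (Q? : Decidable Q) (R? : Decidable R) → (∀ {x} → P x → Q x ⊎ R x) →
            ∀ xs → count P? xs ≤ count Q? xs + count R? xs
  count-⊎ P? Q? R? P⇒Q⊎R []       = z≤n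
  count-⊎ P? Q? R? P⇒Q⊎R (x ∷ xs) with P? x
  ... | no _ = ≤-trans (count-⊎ P? Q? R? P⇒Q⊎R xs) (+-mono-≤ (count-∷ Q? xs) (count-∷ R? xs))
  ... | yes px with P⇒Q⊎R px
  ...   | inj₁ qx with Q? x
  ...     | yes _  = s≤s (≤-trans (count-⊎ P? Q? R? P⇒Q⊎R xs) (+-monoʳ-≤ _ (count-∷ R? xs)))
  ...     | no ¬qx = contradiction qx ¬qx
  count-⊎ P? Q? R? P⇒Q⊎R (x ∷ xs) | yes px | inj₂ rx with R? x
  ...     | yes _  = ≤-trans (s≤s (≤-trans (count-⊎ P? Q? R? P⇒Q⊎R xs) (+-monoˡ-≤ _ (count-∷ Q? xs))))
                             (≤-reflexive (sym (+-suc _ _)))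
  ...     | no ¬rx = contradiction rx ¬rx

  count+count-¬ : (P? : Decidable P) → ∀ xs → count P? xs + count (¬? ∘ P?) xs ≡ length xs
  count+count-¬ P? []       = refl
  count+count-¬ P? (x ∷ xs) with P? x
  ... | yes _ = cong suc (count+count-¬ P? xs)
  ... | no  _ = trans (+-suc _ _) (cong suc (count+count-¬ P? xs))

module _ {A B : Set} {P : Pred A 0ℓ} (P? : Decidable P) (f : B → A) where

  count-map : ∀ zs → count P? (map f zs) ≡ count (P? ∘ f) zs
  count-map []       = refl
  count-map (z ∷ zs) with P? (f z)
  ... | yes _ = cong suc (count-map zs)
  ... | no  _ = count-map zs

module _ {A B C : Set} (f : A → B → C) where

  length-cartesianProductWith : ∀ xs ys → length (cartesianProductWith f xs ys) ≡ length xs * length ys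
  length-cartesianProductWith []       ys = refl
  length-cartesianProductWith (x ∷ xs) ys = begin
    length (map (f x) ys ++ cartesianProductWith f xs ys)
      ≡⟨ length-++ (map (f x) ys) ⟩
    length (map (f x) ys) + length (cartesianProductWith f xs ys)
      ≡⟨ cong₂ _+_ (length-map (f x) ys) (length-cartesianProductWith xs ys) ⟩
    length ys + length xs * length ys
      ∎
    where open ≡-Reasoning

module _ {A B : Set} {P : Pred A 0ℓ} {Q : Pred (A × B) 0ℓ} (P? : Decidable P) (Q? : Decidable Q) where

  count-cartesianProduct : ∀ {c} m ys xs → All (λ y → P y → c ≤ m * count (Q? ∘ (y ,_)) xs) ys →
                           count P? ys * c ≤ m * count Q? (cartesianProduct ys xs)
  count-cartesianProduct         m []       xs []         = z≤n
  count-cartesianProduct {c = c} m (y ∷ ys) xs (hy ∷ hys) = begin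
    count P? (y ∷ ys) * c
      ≤⟨ first-and-rest ⟩
    m * count (Q? ∘ (y ,_)) xs + m * count Q? (cartesianProduct ys xs)
      ≡⟨ *-distribˡ-+ m _ _ ⟨
    m * (count (Q? ∘ (y ,_)) xs + count Q? (cartesianProduct ys xs))
      ≡⟨ cong (λ z → m * (z + count Q? (cartesianProduct ys xs))) (count-map Q? (y ,_) xs) ⟨
    m * (count Q? (map (y ,_) xs) + count Q? (cartesianProduct ys xs))
      ≡⟨ cong (m *_) (count-++ Q? (map (y ,_) xs)) ⟨
    m * count Q? (cartesianProduct (y ∷ ys) xs)
      ∎
    where
    open ≤-Reasoning
    rest : count P? ys * c ≤ m * count Q? (cartesianProduct ys xs)
    rest = count-cartesianProduct m ys xs hys
    first-and-rest : count P? (y ∷ ys) * c ≤ m * count (Q? ∘ (y ,_)) xs + m * count Q? (cartesianProduct ys xs)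
    first-and-rest with P? y
    ... | yes py = +-mono-≤ (hy py) rest
    ... | no  _  = ≤-trans rest (m≤n+m _ _)

module Words (q : ℕ) where

  words : ℕ → List (List (Fin q))
  words zero    = [] ∷ []
  words (suc n) = cartesianProductWith _∷_ (allFin q) (words n)

  words-unique : ∀ n → Unique (words n)
  words-unique zero    = [] ∷ []
  words-unique (suc n) = Unique.cartesianProductWith⁺ _∷_ ∷-injective (Unique.allFin⁺ q) (words-unique n)

  words-length : ∀ n → All (λ w → length w ≡ n) (words n)
  words-length zero    = refl ∷ []
  words-length (suc n) = All.cartesianProductWith⁺ (setoid _) (setoid _) _∷_ (allFin q) (words n)
                           (λ _ w∈ → cong suc (All.lookup (words-length n) w∈))

  length-words : ∀ n → length (words n) ≡ q ^ n
  length-words zero    = refl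
  length-words (suc n) = trans (length-cartesianProductWith _∷_ (allFin q) (words n))
                               (cong₂ _*_ (length-tabulate {n = q} id) (length-words n))

  startsWith? : (p : List (Fin q)) → Decidable (Prefix _≡_ p)
  startsWith? = prefix? _≟_

  contains? : (p : List (Fin q)) → Decidable (Infix _≡_ p)
  contains? = infix? _≟_

  count-drop-head : {P : Pred (List (Fin q)) 0ℓ} (P? : Decidable P) → ∀ cs ws →
                    count (P? ∘ drop 1) (cartesianProductWith _∷_ cs ws) ≡ length cs * count P? ws
  count-drop-head P? []       ws = refl
  count-drop-head P? (c ∷ cs) ws =
    trans (count-++ (P? ∘ drop 1) (map (c ∷_) ws))
          (cong₂ _+_ (count-map (P? ∘ drop 1) (c ∷_) ws) (count-drop-head P? cs ws))

  count-startsWith-∷ : ∀ c p {cs} ws → Unique cs →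
                   count (startsWith? (c ∷ p)) (cartesianProductWith _∷_ cs ws) ≤ count (startsWith? p) ws
  count-startsWith-∷ c p ws [] = z≤n
  count-startsWith-∷ c p {d ∷ cs} ws (d∉cs ∷ cs-unique) with c ≟ d
  ... | yes refl = ≤-reflexive (begin
    count (startsWith? (c ∷ p)) (map (c ∷_) ws ++ rest)
      ≡⟨ count-++ (startsWith? (c ∷ p)) (map (c ∷_) ws) ⟩
    count (startsWith? (c ∷ p)) (map (c ∷_) ws) + count (startsWith? (c ∷ p)) rest
      ≡⟨ cong₂ _+_ (count-map (startsWith? (c ∷ p)) (c ∷_) ws) (absent d∉cs) ⟩
    count (startsWith? (c ∷ p) ∘ (c ∷_)) ws + 0
      ≡⟨ +-identityʳ _ ⟩
    count (startsWith? (c ∷ p) ∘ (c ∷_)) ws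
      ≡⟨ cong length (filter-≐ _ (startsWith? p) (Prefix.tail , (refl ∷_)) ws) ⟩
    count (startsWith? p) ws
      ∎)
    where
    open ≡-Reasoning
    rest = cartesianProductWith _∷_ cs ws
    absent : ∀ {ds} → All (c ≢_) ds → count (startsWith? (c ∷ p)) (cartesianProductWith _∷_ ds ws) ≡ 0
    absent {ds} c∉ds = cong length (filter-none (startsWith? (c ∷ p))
      (All.cartesianProductWith⁺ (setoid _) (setoid _) _∷_ ds ws λ d∈ _ → All.lookup c∉ds d∈ ∘ Prefix.head))
  ... | no c≢d = begin
    count (startsWith? (c ∷ p)) (map (d ∷_) ws ++ rest)
      ≡⟨ count-++ (startsWith? (c ∷ p)) (map (d ∷_) ws) ⟩
    count (startsWith? (c ∷ p)) (map (d ∷_) ws) + count (startsWith? (c ∷ p)) rest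
      ≡⟨ cong (_+ _) (trans (count-map (startsWith? (c ∷ p)) (d ∷_) ws) block-empty) ⟩
    count (startsWith? (c ∷ p)) rest
      ≤⟨ count-startsWith-∷ c p ws cs-unique ⟩
    count (startsWith? p) ws
      ∎
    where
    open ≤-Reasoning
    rest = cartesianProductWith _∷_ cs ws
    block-empty : count (startsWith? (c ∷ p) ∘ (d ∷_)) ws ≡ 0
    block-empty = cong length (filter-none _ (All.universal (λ _ → c≢d ∘ Prefix.head) ws))

  count-startsWith : ∀ p n → count (startsWith? p) (words n) * q ^ length p ≤ q ^ n
  count-startsWith []      n       = ≤-reflexive (begin
    count (startsWith? []) (words n) * 1   ≡⟨ *-identityʳ _ ⟩
    count (startsWith? []) (words n)       ≡⟨ cong length (filter-all (startsWith? []) (All.universal (λ _ → []) (words n))) ⟩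
    length (words n)                       ≡⟨ length-words n ⟩
    q ^ n                                  ∎)
    where open ≡-Reasoning
  count-startsWith (c ∷ p) zero    = z≤n
  count-startsWith (c ∷ p) (suc n) = begin
    count (startsWith? (c ∷ p)) (words (suc n)) * (q * q ^ length p)
      ≤⟨ *-monoˡ-≤ _ (count-startsWith-∷ c p (words n) (Unique.allFin⁺ q)) ⟩
    count (startsWith? p) (words n) * (q * q ^ length p)
      ≡⟨ x∙yz≈y∙xz (count (startsWith? p) (words n)) q (q ^ length p) ⟩
    q * (count (startsWith? p) (words n) * q ^ length p)
      ≤⟨ *-monoʳ-≤ q (count-startsWith p n) ⟩
    q * q ^ n
      ∎
    where open ≤-Reasoning

  contains⇒startsWith⊎contains-tail : ∀ {p w : List (Fin q)} → Infix _≡_ p w → Prefix _≡_ p w ⊎ Infix _≡_ p (drop 1 w)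
  contains⇒startsWith⊎contains-tail (here pr) = inj₁ pr
  contains⇒startsWith⊎contains-tail (there i) = inj₂ i

  count-contains : ∀ p n → count (contains? p) (words n) * q ^ length p ≤ suc n * q ^ n
  count-contains []      zero    = ≤-refl
  count-contains (c ∷ p) zero    = z≤n
  count-contains p       (suc n) = begin
    count (contains? p) (words (suc n)) * Qᵖ
      ≤⟨ *-monoˡ-≤ Qᵖ (count-⊎ (contains? p) (startsWith? p) (contains? p ∘ drop 1)
                               contains⇒startsWith⊎contains-tail (words (suc n))) ⟩
    (count (startsWith? p) (words (suc n)) + count (contains? p ∘ drop 1) (words (suc n))) * Qᵖ
      ≡⟨ cong (λ z → (count (startsWith? p) (words (suc n)) + z) * Qᵖ) count-tail ⟩
    (count (startsWith? p) (words (suc n)) + q * count (contains? p) (words n)) * Qᵖ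
      ≡⟨ *-distribʳ-+ Qᵖ (count (startsWith? p) (words (suc n))) (q * count (contains? p) (words n)) ⟩
    count (startsWith? p) (words (suc n)) * Qᵖ + q * count (contains? p) (words n) * Qᵖ
      ≡⟨ cong (count (startsWith? p) (words (suc n)) * Qᵖ +_) (*-assoc q (count (contains? p) (words n)) Qᵖ) ⟩
    count (startsWith? p) (words (suc n)) * Qᵖ + q * (count (contains? p) (words n) * Qᵖ)
      ≤⟨ +-mono-≤ (count-startsWith p (suc n)) (*-monoʳ-≤ q (count-contains p n)) ⟩
    q ^ suc n + q * (suc n * q ^ n)
      ≡⟨ cong (q ^ suc n +_) (x∙yz≈y∙xz q (suc n) (q ^ n)) ⟩
    suc (suc n) * q ^ suc n
      ∎
    where
    open ≤-Reasoning
    Qᵖ = q ^ length p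
    count-tail : count (contains? p ∘ drop 1) (words (suc n)) ≡ q * count (contains? p) (words n)
    count-tail = trans (count-drop-head (contains? p) (allFin q) (words n))
                       (cong (_* count (contains? p) (words n)) (length-tabulate {n = q} id))

  count-avoiding : ∀ p n → 2 * suc n ≤ q ^ length p → q ^ n ≤ 2 * count (¬? ∘ contains? p) (words n)
  count-avoiding p n long = +-cancelʳ-≤ (q ^ n) (q ^ n) (2 * good) (begin
    q ^ n + q ^ n                     ≡⟨ cong (λ z → z + z) total ⟨
    (bad + good) + (bad + good)       ≡⟨ rearrange bad good ⟩
    2 * good + 2 * bad                ≤⟨ +-monoʳ-≤ (2 * good) twice-bad ⟩
    2 * good + q ^ n                  ∎)
    where
    open ≤-Reasoning
    bad  = count (contains? p) (words n)
    good = count (¬? ∘ contains? p) (words n)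
    total : bad + good ≡ q ^ n
    total = trans (count+count-¬ (contains? p) (words n)) (length-words n)
    twice-bad : 2 * bad ≤ q ^ n
    twice-bad = *-cancelʳ-≤ (2 * bad) (q ^ n) (suc n) (begin
      2 * bad * suc n      ≡⟨ trans (*-assoc 2 bad (suc n)) (x∙yz≈y∙xz 2 bad (suc n)) ⟩
      bad * (2 * suc n)    ≤⟨ *-monoʳ-≤ bad long ⟩
      bad * q ^ length p   ≤⟨ count-contains p n ⟩
      suc n * q ^ n        ≡⟨ *-comm (suc n) (q ^ n) ⟩
      q ^ n * suc n        ∎)
    rearrange : ∀ b g → (b + g) + (b + g) ≡ 2 * g + 2 * b
    rearrange = solve-∀

-- The lower bound

4t+8≤2^t : ∀ t → 5 ≤ t → 4 * t + 8 ≤ 2 ^ t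
4t+8≤2^t t 5≤t with m≤n⇒∃[o]m+o≡n 5≤t
... | d , refl = from-five d
  where
  open ≤-Reasoning
  from-five : ∀ d → 4 * (5 + d) + 8 ≤ 2 ^ (5 + d)
  from-five zero    = m≤m+n 28 4
  from-five (suc d) = begin
    4 * (5 + suc d) + 8                 ≡⟨ grow d ⟩
    (4 * (5 + d) + 8) + 4               ≤⟨ +-mono-≤ (from-five d) four≤ ⟩
    2 ^ (5 + d) + 2 ^ (5 + d)           ≡⟨ cong (2 ^ (5 + d) +_) (+-identityʳ _) ⟨
    2 ^ (5 + suc d)                     ∎
    where
    grow : ∀ d → 4 * (5 + suc d) + 8 ≡ (4 * (5 + d) + 8) + 4
    grow = solve-∀
    four≤ : 4 ≤ 2 ^ (5 + d)
    four≤ = ≤-trans (m≤n+m 4 (4 * (5 + d) + 4)) (≤-trans (≤-reflexive (+-assoc (4 * (5 + d)) 4 4)) (from-five d))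

power-between : ∀ m .{{_ : NonZero m}} X d → 1 ≤ X → X ≤ m ^ (2 + d) →
                ∃[ j ] (2 ≤ j × j ≤ 2 + d × X ≤ m ^ j × m ^ j ≤ m * m * X)
power-between m X zero    1≤X X≤m² = 2 , ≤-refl , ≤-refl , X≤m² ,
  ≤-trans (≤-reflexive (sym (*-assoc m m 1))) (*-monoʳ-≤ (m * m) 1≤X)
power-between m X (suc d) 1≤X X≤m^j with X ≤? m ^ (2 + d)
... | yes X≤m^j′ with power-between m X d 1≤X X≤m^j′
...   | j , 2≤j , j≤ , lower , upper = j , 2≤j , m≤n⇒m≤1+n j≤ , lower , upper
power-between m X (suc d) 1≤X X≤m^j | no X≰m^j′ = 3 + d , s≤s (s≤s z≤n) , ≤-refl , X≤m^j , (begin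
  m * m ^ (2 + d)   ≤⟨ *-monoʳ-≤ m (<⇒≤ (≰⇒> X≰m^j′)) ⟩
  m * X             ≤⟨ *-monoʳ-≤ m (m≤n*m X m) ⟩
  m * (m * X)       ≡⟨ *-assoc m m X ⟨
  m * m * X         ∎)
  where open ≤-Reasoning

module LowerBound (r : ℕ) where

  q : ℕ
  q = suc (suc r)

  2≤q : 2 ≤ q
  2≤q = s≤s (s≤s z≤n)

  open Words q

  module Framed (j : ℕ) (2≤j : 2 ≤ j) where

    open Construction {Fin q} zero (suc zero) (λ ()) j 2≤j public

    Good : Pred (List (Fin q) × List (Fin q)) 0ℓ
    Good (y , x) = ¬ Infix _≡_ aʲ y × ¬ Infix _≡_ (U y) x

    good? : Decidable Good
    good? (y , x) = ¬? (contains? aʲ y) ×-dec ¬? (contains? (U y) x)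

    good-pairs : ℕ → ℕ → List (List (Fin q) × List (Fin q))
    good-pairs Y M = filter good? (cartesianProduct (words Y) (words M))

    privileged-words : ℕ → ℕ → List (List (Fin q))
    privileged-words Y M = map (uncurry W) (good-pairs Y M)

    good-pairs-length : ∀ Y M → All (λ (y , x) → length y ≡ Y × length x ≡ M) (good-pairs Y M)
    good-pairs-length Y M = All.filter⁺ good? (All.cartesianProduct⁺ (setoid _) (setoid _) (words Y) (words M)
      (λ y∈ x∈ → All.lookup (words-length Y) y∈ , All.lookup (words-length M) x∈))

    privileged-words-unique : ∀ Y M → Unique (privileged-words Y M)
    privileged-words-unique Y M = Unique.map⁻ (subst Unique (sym decode∘W)
      (Unique.filter⁺ good? (Unique.cartesianProduct⁺ (words-unique Y) (words-unique M))))
      where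
      decode∘W : map (decode Y M) (privileged-words Y M) ≡ good-pairs Y M
      decode∘W = trans (sym (map-∘ (good-pairs Y M)))
                       (map-id-local (All.map (λ { {y , x} (refl , refl) → decode-W y x }) (good-pairs-length Y M)))

    privileged-words-sound : ∀ Y M → All (λ w → length w ≡ ℓW Y M × Privileged w) (privileged-words Y M)
    privileged-words-sound Y M = All.map⁺ (All.zipWith
      (λ { {y , x} ((avy , avx) , (refl , refl)) → length-W y x , W-privileged avy avx })
      (All.all-filter good? (cartesianProduct (words Y) (words M)) , good-pairs-length Y M))

    length-privileged-words : ∀ Y M → 2 * suc Y ≤ q ^ j → 2 * suc M ≤ q ^ ℓU Y →
                              q ^ Y * q ^ M ≤ 4 * length (privileged-words Y M)
    length-privileged-words Y M short-y short-x = begin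
      q ^ Y * q ^ M
        ≤⟨ *-monoˡ-≤ (q ^ M) (count-avoiding aʲ Y (subst (λ l → 2 * suc Y ≤ q ^ l) (sym length-aʲ) short-y)) ⟩
      2 * count (¬? ∘ contains? aʲ) (words Y) * q ^ M
        ≡⟨ *-assoc 2 (count (¬? ∘ contains? aʲ) (words Y)) (q ^ M) ⟩
      2 * (count (¬? ∘ contains? aʲ) (words Y) * q ^ M)
        ≤⟨ *-monoʳ-≤ 2 (count-cartesianProduct (¬? ∘ contains? aʲ) good? 2 (words Y) (words M)
                                                (All.map enough-x (words-length Y))) ⟩
      2 * (2 * count good? (cartesianProduct (words Y) (words M)))
        ≡⟨ *-assoc 2 2 (length (good-pairs Y M)) ⟨
      4 * length (good-pairs Y M)
        ≡⟨ cong (4 *_) (length-map (uncurry W) (good-pairs Y M)) ⟨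
      4 * length (privileged-words Y M)
        ∎
      where
      open ≤-Reasoning
      enough-x : ∀ {y} → length y ≡ Y → ¬ Infix _≡_ aʲ y → q ^ M ≤ 2 * count (good? ∘ (y ,_)) (words M)
      enough-x {y} refl avy = subst (λ c → q ^ M ≤ 2 * c)
        (cong length (filter-≐ (¬? ∘ contains? (U y)) (good? ∘ (y ,_)) ((avy ,_) , proj₂) (words M)))
        (count-avoiding (U y) M (subst (λ l → 2 * suc M ≤ q ^ l) (sym (length-U y)) short-x))

  halve : ∀ n → n / 2 * 2 ≤ n × n ≤ suc (n / 2 * 2)
  halve n = ≤-trans (m≤n+m _ (n % 2)) (≤-reflexive (sym n≡)) ,
            ≤-trans (≤-reflexive n≡) (+-monoˡ-≤ _ (s≤s⁻¹ (m%n<n n 2)))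
    where
    n≡ : n ≡ n % 2 + n / 2 * 2
    n≡ = m≡m%n+[m/n]*n n 2

  -- q^j ≥ 2(L+1) makes most y of length ≤ L avoid aʲ; q^j ≤ 2q²(L+1) keeps the price q^(2j) of the two
  -- blocks aʲ at O(q⁴L²).
  block-length : ∀ L → 12 ≤ L → ∃[ j ] (2 ≤ j × j + j + 2 ≤ L × 2 * suc L ≤ q ^ j × q ^ j ≤ 4 * (q * q) * L)
  block-length L 12≤L = choose (m≤n⇒∃[o]m+o≡n 6≤h)
    where
    open ≤-Reasoning
    h = L / 2
    h*2≤L : h * 2 ≤ L
    h*2≤L = proj₁ (halve L)
    L≤1+h*2 : L ≤ suc (h * 2)
    L≤1+h*2 = proj₂ (halve L)
    6≤h : 6 ≤ h
    6≤h = *-cancelʳ-< 2 5 h (s≤s⁻¹ (≤-trans 12≤L L≤1+h*2))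
    choose : ∃[ d ] 6 + d ≡ h → ∃[ j ] (2 ≤ j × j + j + 2 ≤ L × 2 * suc L ≤ q ^ j × q ^ j ≤ 4 * (q * q) * L)
    choose (d , 6+d≡h) with power-between q (2 * suc L) (3 + d) (s≤s z≤n) fits
      where
      fits : 2 * suc L ≤ q ^ (5 + d)
      fits = begin
        2 * suc L               ≤⟨ *-monoʳ-≤ 2 (s≤s L≤1+h*2) ⟩
        2 * (2 + h * 2)         ≡⟨ cong (λ z → 2 * (2 + z * 2)) 6+d≡h ⟨
        2 * (2 + (6 + d) * 2)   ≡⟨ lemma d ⟩
        4 * (5 + d) + 8         ≤⟨ 4t+8≤2^t (5 + d) (s≤s (s≤s (s≤s (s≤s (s≤s z≤n))))) ⟩
        2 ^ (5 + d)             ≤⟨ ^-monoˡ-≤ (5 + d) 2≤q ⟩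
        q ^ (5 + d)             ∎
        where
        lemma : ∀ d → 2 * (2 + (6 + d) * 2) ≡ 4 * (5 + d) + 8
        lemma = solve-∀
    ... | j , 2≤j , j≤5+d , lower , upper = j , 2≤j , j+j+2≤L , lower , ≤-trans upper q²[2+2L]≤4q²L
      where
      j+j+2≤L : j + j + 2 ≤ L
      j+j+2≤L = begin
        j + j + 2               ≤⟨ +-monoˡ-≤ 2 (+-mono-≤ j≤5+d j≤5+d) ⟩
        (5 + d) + (5 + d) + 2   ≡⟨ lemma d ⟩
        (6 + d) * 2             ≡⟨ cong (_* 2) 6+d≡h ⟩
        h * 2                   ≤⟨ h*2≤L ⟩
        L                       ∎
        where
        lemma : ∀ d → (5 + d) + (5 + d) + 2 ≡ (6 + d) * 2
        lemma = solve-∀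
      q²[2+2L]≤4q²L : q * q * (2 * suc L) ≤ 4 * (q * q) * L
      q²[2+2L]≤4q²L = begin
        q * q * (2 * suc L)     ≤⟨ *-monoʳ-≤ (q * q) (*-monoʳ-≤ 2 (+-monoˡ-≤ L (≤-trans (s≤s z≤n) 12≤L))) ⟩
        q * q * (2 * (L + L))   ≡⟨ lemma (q * q) L ⟩
        4 * (q * q) * L         ∎
        where
        lemma : ∀ a L → a * (2 * (L + L)) ≡ 4 * a * L
        lemma = solve-∀

  large-exponent : ∀ {n L} → q ^ 12 ≤ n → n < q ^ suc L → 12 ≤ L
  large-exponent {n} {L} n₀≤n n<qᴸ⁺¹ = ≮⇒≥ (λ L<12 → <⇒≱ n<qᴸ⁺¹ (≤-trans (^-monoʳ-≤ q L<12) n₀≤n))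

  room-for-frame : ∀ {n L} → 12 ≤ L → q ^ L ≤ n → 2 * L + 10 ≤ n
  room-for-frame {n} {L} 12≤L qᴸ≤n = begin
    2 * L + 10              ≡⟨ +-assoc (2 * L) 2 8 ⟨
    2 * L + 2 + 8           ≤⟨ +-monoˡ-≤ 8 (+-monoʳ-≤ (2 * L) (*-monoʳ-≤ 2 (≤-trans (s≤s z≤n) 12≤L))) ⟩
    2 * L + 2 * L + 8       ≡⟨ cong (_+ 8) (sym (*-distribʳ-+ L 2 2)) ⟩
    4 * L + 8               ≤⟨ 4t+8≤2^t L (≤-trans (s≤s (s≤s (s≤s (s≤s (s≤s z≤n))))) 12≤L) ⟩
    2 ^ L                   ≤⟨ ^-monoˡ-≤ L 2≤q ⟩
    q ^ L                   ≤⟨ qᴸ≤n ⟩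
    n                       ∎
    where open ≤-Reasoning

  counting-estimate : ∀ {n L j Y M w} → n ≡ Y + (M + (L + (j + (j + 12)))) →
                      q ^ Y * q ^ M ≤ 4 * w → q ^ L ≤ n → q ^ j ≤ 4 * (q * q) * L →
                      q ^ n ≤ 64 * q ^ 16 * n * (L * L) * w
  counting-estimate {n} {L} {j} {Y} {M} {w} n≡ qʸqᴹ≤4w qᴸ≤n qʲ≤ = begin
    q ^ n                                                      ≡⟨ cong (q ^_) n≡ ⟩
    q ^ (Y + (M + (L + (j + (j + 12)))))                       ≡⟨ exponents ⟩
    q ^ Y * (q ^ M * (q ^ L * (q ^ j * (q ^ j * q ^ 12))))      ≡⟨ regroup (q ^ Y) (q ^ M) (q ^ L) (q ^ j) (q ^ 12) ⟩
    q ^ Y * q ^ M * q ^ L * (q ^ j * q ^ j) * q ^ 12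
      ≤⟨ *-monoˡ-≤ (q ^ 12) (*-mono-≤ (*-mono-≤ qʸqᴹ≤4w qᴸ≤n) (*-mono-≤ qʲ≤ qʲ≤)) ⟩
    4 * w * n * (4 * (q * q) * L * (4 * (q * q) * L)) * q ^ 12  ≡⟨ collect w n q L (q ^ 12) ⟩
    64 * (q ^ 4 * q ^ 12) * n * (L * L) * w                    ≡⟨ cong (λ z → 64 * z * n * (L * L) * w) (^-distribˡ-+-* q 4 12) ⟨
    64 * q ^ 16 * n * (L * L) * w                              ∎
    where
    open ≤-Reasoning
    exponents : q ^ (Y + (M + (L + (j + (j + 12))))) ≡ q ^ Y * (q ^ M * (q ^ L * (q ^ j * (q ^ j * q ^ 12))))
    exponents = trans (^-distribˡ-+-* q Y _) (cong (q ^ Y *_)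
                (trans (^-distribˡ-+-* q M _) (cong (q ^ M *_)
                (trans (^-distribˡ-+-* q L _) (cong (q ^ L *_)
                (trans (^-distribˡ-+-* q j _) (cong (q ^ j *_) (^-distribˡ-+-* q j 12))))))))
    regroup : ∀ a b c d e → a * (b * (c * (d * (d * e)))) ≡ a * b * c * (d * d) * e
    regroup = solve-∀
    collect : ∀ a b c d e → 4 * a * b * (4 * (c * c) * d * (4 * (c * c) * d)) * e
                          ≡ 64 * (c * (c * (c * (c * 1))) * e) * b * (d * d) * a
    collect = solve-∀

  ManyPrivileged : ℕ → ℕ → Set
  ManyPrivileged n L = ∃[ ws ] (Unique {A = List (Fin q)} ws × All (λ w → length w ≡ n × Privileged w) ws
                      × q ^ n ≤ 64 * q ^ 16 * n * (L * L) * length ws)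

  privileged-words-exist : ∀ {n L j Y M} → 2 ≤ j → j + j + 2 + Y ≡ L → 2 * L + 10 + M ≡ n →
                           2 * suc L ≤ q ^ j → q ^ j ≤ 4 * (q * q) * L → q ^ L ≤ n → n < q ^ suc L → ManyPrivileged n L
  privileged-words-exist {n} {L} {j} {Y} {M} 2≤j L≡ n≡ qʲ-lower qʲ-upper qᴸ≤n n<qᴸ⁺¹ =
    privileged-words Y M ,
    privileged-words-unique Y M ,
    All.map (λ (ℓ , p) → trans ℓ word-length , p) (privileged-words-sound Y M) ,
    counting-estimate {n} {L} {j} {Y} {M} {length (privileged-words Y M)}
      exponent (length-privileged-words Y M short-y short-x) qᴸ≤n qʲ-upper
    where
    open Framed j 2≤j
    word-length : ℓW Y M ≡ n
    word-length = trans (identity j Y M) (trans (cong (λ l → 2 * l + 10 + M) L≡) n≡)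
      where
      identity : ∀ j Y M → (j + (2 + (Y + 2)) + j) + (3 + (M + 3)) + (j + (2 + (Y + 2)) + j) ≡ 2 * (j + j + 2 + Y) + 10 + M
      identity = solve-∀
    exponent : n ≡ Y + (M + (L + (j + (j + 12))))
    exponent = trans (sym n≡) (trans (cong (λ l → 2 * l + 10 + M) (sym L≡))
                 (trans (identity j Y M) (cong (λ l → Y + (M + (l + (j + (j + 12))))) L≡)))
      where
      identity : ∀ j Y M → 2 * (j + j + 2 + Y) + 10 + M ≡ Y + (M + ((j + j + 2 + Y) + (j + (j + 12))))
      identity = solve-∀
    short-y : 2 * suc Y ≤ q ^ j
    short-y = ≤-trans (*-monoʳ-≤ 2 (s≤s (≤-trans (m≤n+m Y (j + j + 2)) (≤-reflexive L≡)))) qʲ-lower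
    short-x : 2 * suc M ≤ q ^ ℓU Y
    short-x = subst (λ l → 2 * suc M ≤ q ^ l) (sym (trans (identity j Y) (cong (2 +_) L≡)))
      (≤-trans (*-monoʳ-≤ 2 (≤-trans (s≤s (≤-trans (m≤n+m M (2 * L + 10)) (≤-reflexive n≡))) n<qᴸ⁺¹))
               (*-monoˡ-≤ (q ^ suc L) 2≤q))
      where
      identity : ∀ j Y → j + (2 + (Y + 2)) + j ≡ 2 + (j + j + 2 + Y)
      identity = solve-∀

  many-privileged : ∀ n L → q ^ 12 ≤ n → q ^ L ≤ n → n < q ^ suc L → ManyPrivileged n L
  many-privileged n L n₀≤n qᴸ≤n n<qᴸ⁺¹ =
    let 12≤L                                   = large-exponent n₀≤n n<qᴸ⁺¹
        j , 2≤j , j+j+2≤L , qʲ-lower , qʲ-upper = block-length L 12≤L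
        M , n≡                                 = m≤n⇒∃[o]m+o≡n (room-for-frame 12≤L qᴸ≤n)
        Y , L≡                                 = m≤n⇒∃[o]m+o≡n j+j+2≤L
    in privileged-words-exist 2≤j L≡ n≡ qʲ-lower qʲ-upper qᴸ≤n n<qᴸ⁺¹

theorem1 : (q : ℕ) → 2 ≤ q →
    ∃[ k ] (1 ≤ k × ∃[ n₀ ] (∀ n → n₀ ≤ n → ∀ L → q ^ L ≤ n → n < q ^ suc L →
      ∃[ ws ] (Unique {A = List (Fin q)} ws
        × All (λ w → length w ≡ n × Privileged w) ws
        × q ^ n ≤ k * n * (L * L) * length ws)))
theorem1 zero          ()
theorem1 (suc zero)    (s≤s ())
theorem1 (suc (suc r)) _ = 64 * q ^ 16 , *-mono-≤ {1} {64} (s≤s z≤n) (m^n>0 q 16) , q ^ 12 ,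
  λ n n₀≤n L → many-privileged n L n₀≤n
  where open LowerBound r
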